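{- For every integer $k>0$, \[\zeta_{\mathcal P}(\{2\}^k):=\sum_{\ell(\lambda)=k}\frac{1}{n_\lambda^2}=\frac{2^{2k-1}-1}{2^{2k-2}}\,\zeta(2k),\] where the sum runs over all integer partitions $\lambda$ with exactly $k$ parts, $n_\lambda$ is the product of the parts of $\lambda$, and $\zeta$ is the Riemann zeta function. -}

module Defs where

open import Data.Nat as ℕ using (ℕ; zero; suc; _∸_; _^_)
open import Data.Nat.Properties using (m^n≢0)
open import Data.List using (List; []; _∷_; [_]; map; concatMap; foldr)
open import Data.Nat.ListAction using (product)
open import Data.Integer using (+_)
open import Data.Rational using (ℚ; 0ℚ; _/_; _+_; _*_; _-_; ∣_∣; _<_)
open import Data.Product using (∃)

range1 : ℕ → List ℕ
range1 zero = []
range1 (suc n) = range1 n Data.List.++ [ suc n ]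

-- All integer partitions with exactly k parts, every part ≤ n, each listed once
-- as a weakly decreasing list of positive parts (largest part first).
partitionsBounded : ℕ → ℕ → List (List ℕ)
partitionsBounded zero n = [ [] ]
partitionsBounded (suc k) n =
  concatMap (λ m → map (m ∷_) (partitionsBounded k m)) (range1 n)

sumℚ : List ℚ → ℚ
sumℚ = foldr _+_ 0ℚ

-- invPow e m = 1 / m^e  (for m ≥ 1; the value at 0 is never used)
invPow : ℕ → ℕ → ℚ
invPow e zero = 0ℚ
invPow e (suc m) = (+ 1 / (suc m ^ e)) {{m^n≢0 (suc m) e}}

zetaPPartial : ℕ → ℕ → ℚ
zetaPPartial k n = sumℚ (map (λ λs → invPow 2 (product λs)) (partitionsBounded k n))

zetaPartial : ℕ → ℕ → ℚ
zetaPartial s n = sumℚ (map (invPow s) (range1 n))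

coeff : ℕ → ℚ
coeff k = (+ (2 ^ (2 ℕ.* k ∸ 1) ∸ 1) / (2 ^ (2 ℕ.* k ∸ 2))) {{m^n≢0 2 (2 ℕ.* k ∸ 2)}}

module Submission where

-- Put x m = 1/m².  The partial sum H k n = zetaPPartial k n (partitions with k parts,
-- all parts ≤ n) is the complete homogeneous symmetric polynomial h_k(x_1,…,x_n), so
-- H (k+1) n = Σ_{m≤n} x_m · H k m.  For n ≥ 1 the partial-fraction expression
--   Q k n = Σ_{m≤n} B n m · x_m^k,   B n m = 2(-1)^{m-1} T n m,   T n m = Π_{i<m} (n-i)/(n+1+i)
-- satisfies the same recursion and Q 0 n = 1, hence H k n = Q k n (`partialFraction`).
-- Since T n m ≈ 1 for m ≪ √n, for k ≥ 2 the error H k n - coeff k · ζ_n(2k) splits into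
--   Σ_m (B n m - 2(-1)^{m-1}) x_m^k,  bounded by 4/n because (1 - T n m)·n ≤ m², and
--   Σ_m 2(-1)^{m-1} x_m^k - coeff k · ζ_n(2k) = 4^{1-k} (ζ_n(2k) - ζ_{⌊n/2⌋}(2k)),
-- a tail of Σ 1/m², bounded by 1/⌊n/2⌋.  For k = 1 the error vanishes identically.

open import Defs
open import Data.Nat as ℕ using (ℕ; zero; suc; z≤n; s≤s; ⌊_/2⌋)
import Data.Nat.Properties as ℕ
open import Data.Integer as ℤ using (+_)
import Data.Integer.Properties as ℤ
open import Data.Rational hiding (truncate)
open import Data.Rational.Properties
import Data.Rational.Unnormalised as ℚᵘ
import Data.Rational.Unnormalised.Properties as ℚᵘ
open import Data.List using (List; []; _∷_; [_]; map; concatMap; _++_)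
open import Data.List.Properties using (map-++; map-cong)
open import Data.Nat.ListAction using (product)
open import Data.Product using (_×_; _,_; proj₁; proj₂; ∃)
open import Data.Sum using (_⊎_; inj₁; inj₂)
open import Relation.Binary.PropositionalEquality hiding ([_])
open import Data.Rational.Solver using (module +-*-Solver)
open +-*-Solver

ι : ℕ → ℚ
ι n = + n / 1

recip : ℕ → ℚ
recip b = + 1 / suc b

infixr 8 _^_
_^_ : ℚ → ℕ → ℚ
p ^ zero = 1ℚ
p ^ suc k = p * p ^ k

^-distrib-* : ∀ a b k → (a * b) ^ k ≡ a ^ k * b ^ k
^-distrib-* a b zero = refl
^-distrib-* a b (suc k) = trans (cong (a * b *_) (^-distrib-* a b k))
  (solve 4 (λ a b u v → a :* b :* (u :* v) := a :* u :* (b :* v)) refl a b (a ^ k) (b ^ k))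

^-*-assoc : ∀ p m k → p ^ (m ℕ.* k) ≡ (p ^ m) ^ k
^-*-assoc p m zero = cong (p ^_) (ℕ.*-zeroʳ m)
^-*-assoc p m (suc k) = begin
  p ^ (m ℕ.* suc k)        ≡⟨ cong (p ^_) (trans (ℕ.*-suc m k) (ℕ.+-comm m (m ℕ.* k))) ⟩
  p ^ (m ℕ.* k ℕ.+ m)      ≡⟨ ^-+ (m ℕ.* k) m ⟩
  p ^ (m ℕ.* k) * p ^ m    ≡⟨ cong (_* p ^ m) (^-*-assoc p m k) ⟩
  (p ^ m) ^ k * p ^ m      ≡⟨ *-comm ((p ^ m) ^ k) (p ^ m) ⟩
  (p ^ m) ^ suc k          ∎
  where
  open ≡-Reasoning
  ^-+ : ∀ i j → p ^ (i ℕ.+ j) ≡ p ^ i * p ^ j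
  ^-+ zero j = sym (*-identityˡ (p ^ j))
  ^-+ (suc i) j = trans (cong (p *_) (^-+ i j)) (sym (*-assoc p (p ^ i) (p ^ j)))

-- A fraction with denominator b+1 is, as an unnormalised rational, literally i/(b+1);
-- this reduces identities between such fractions to integer arithmetic.
fraction≃ : ∀ i b → toℚᵘ (i / suc b) ℚᵘ.≃ ℚᵘ.mkℚᵘ i b
fraction≃ i b = toℚᵘ-fromℚᵘ (ℚᵘ.mkℚᵘ i b)

fraction-* : ∀ a b c d .{{_ : ℕ.NonZero b}} .{{_ : ℕ.NonZero d}} →
  (a / b) * (c / d) ≡ ((a ℤ.* c) / (b ℕ.* d)) {{ℕ.m*n≢0 b d}}
fraction-* a (suc b) c (suc d) = toℚᵘ-injective (ℚᵘ.≃-trans (toℚᵘ-homo-* (a / suc b) (c / suc d))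
  (ℚᵘ.≃-trans (ℚᵘ.*-cong (fraction≃ a b) (fraction≃ c d)) (ℚᵘ.≃-sym (fraction≃ (a ℤ.* c) _))))

fraction-+ : ∀ a b c d →
  (a / suc b) + (c / suc d) ≡ (a ℤ.* + suc d ℤ.+ c ℤ.* + suc b) / (suc b ℕ.* suc d)
fraction-+ a b c d = toℚᵘ-injective (ℚᵘ.≃-trans (toℚᵘ-homo-+ (a / suc b) (c / suc d))
  (ℚᵘ.≃-trans (ℚᵘ.+-cong (fraction≃ a b) (fraction≃ c d)) (ℚᵘ.≃-sym (fraction≃ _ _))))

fraction-cong : ∀ a b c d → a ℤ.* + suc d ≡ c ℤ.* + suc b → a / suc b ≡ c / suc d
fraction-cong a b c d eq =
  toℚᵘ-injective (ℚᵘ.≃-trans (fraction≃ a b) (ℚᵘ.≃-trans (ℚᵘ.*≡* eq) (ℚᵘ.≃-sym (fraction≃ c d))))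

ι-+ : ∀ a b → ι (a ℕ.+ b) ≡ ι a + ι b
ι-+ a b = trans (cong (λ z → z / 1) numerators) (sym (fraction-+ (+ a) 0 (+ b) 0))
  where
  numerators : + (a ℕ.+ b) ≡ + a ℤ.* + 1 ℤ.+ + b ℤ.* + 1
  numerators = trans (ℤ.pos-+ a b)
    (cong₂ ℤ._+_ (sym (ℤ.*-identityʳ (+ a))) (sym (ℤ.*-identityʳ (+ b))))

ι-suc : ∀ a → ι (suc a) ≡ 1ℚ + ι a
ι-suc = ι-+ 1

ι-∸ : ∀ n m → m ℕ.≤ n → ι n ≡ ι (n ℕ.∸ m) + ι m
ι-∸ n m m≤n = trans (cong ι (sym (ℕ.m∸n+n≡m m≤n))) (ι-+ (n ℕ.∸ m) m)

ι-recip : ∀ b → ι (suc b) * recip b ≡ 1ℚ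
ι-recip b = trans (fraction-* (+ suc b) 1 (+ 1) (suc b)) (fraction-cong (+ suc b ℤ.* + 1) _ (+ 1) 0 cross)
  where
  cross : (+ suc b ℤ.* + 1) ℤ.* + 1 ≡ + 1 ℤ.* + (1 ℕ.* suc b)
  cross = trans (ℤ.*-identityʳ _) (trans (ℤ.*-identityʳ _)
    (sym (trans (ℤ.*-identityˡ _) (cong +_ (ℕ.*-identityˡ (suc b))))))

fraction-as-product : ∀ a d → + a / suc d ≡ ι a * recip d
fraction-as-product a d = sym (trans (fraction-* (+ a) 1 (+ 1) (suc d))
  (/-cong (ℤ.*-identityʳ (+ a)) (ℕ.*-identityˡ (suc d))))

0≤1 : 0ℚ ≤ 1ℚ
0≤1 = *≤* (ℤ.+≤+ z≤n)

0≤* : ∀ {a b} → 0ℚ ≤ a → 0ℚ ≤ b → 0ℚ ≤ a * b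
0≤* {a} {b} 0≤a 0≤b = subst (_≤ a * b) (*-zeroʳ a) (*-monoˡ-≤-nonNeg a {{nonNegative 0≤a}} 0≤b)

0≤+ : ∀ {a b} → 0ℚ ≤ a → 0ℚ ≤ b → 0ℚ ≤ a + b
0≤+ = +-mono-≤

0≤ι : ∀ a → 0ℚ ≤ ι a
0≤ι a = toℚᵘ-cancel-≤ (ℚᵘ.≤-respʳ-≃ (ℚᵘ.≃-sym (fraction≃ (+ a) 0))
  (ℚᵘ.*≤* (subst (ℤ._≤_ (+ 0)) (sym (ℤ.*-identityʳ (+ a))) (ℤ.+≤+ z≤n))))

0≤recip : ∀ b → 0ℚ ≤ recip b
0≤recip b = toℚᵘ-cancel-≤ (ℚᵘ.≤-respʳ-≃ (ℚᵘ.≃-sym (fraction≃ (+ 1) b)) (ℚᵘ.*≤* (ℤ.+≤+ z≤n)))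

0≤^ : ∀ {p} k → 0ℚ ≤ p → 0ℚ ≤ p ^ k
0≤^ zero 0≤p = 0≤1
0≤^ (suc k) 0≤p = 0≤* 0≤p (0≤^ k 0≤p)

gap⇒≤ : ∀ {p q r} → 0ℚ ≤ r → q ≡ p + r → p ≤ q
gap⇒≤ {p} {q} {r} 0≤r q≡p+r =
  subst₂ _≤_ (+-identityʳ p) (sym q≡p+r) (+-monoʳ-≤ p 0≤r)

≤⇒0≤gap : ∀ {p q} → p ≤ q → 0ℚ ≤ q - p
≤⇒0≤gap {p} {q} p≤q = subst (_≤ q - p) (+-inverseʳ p) (+-monoˡ-≤ (- p) p≤q)

≤1-*ˡ : ∀ {p s} → 0ℚ ≤ s → p ≤ 1ℚ → p * s ≤ s
≤1-*ˡ {p} {s} 0≤s p≤1 = subst (p * s ≤_) (*-identityˡ s) (*-monoʳ-≤-nonNeg s {{nonNegative 0≤s}} p≤1)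

≤1-* : ∀ {p s} → 0ℚ ≤ p → p ≤ 1ℚ → s ≤ 1ℚ → p * s ≤ 1ℚ
≤1-* {p} {s} 0≤p p≤1 s≤1 =
  ≤-trans (subst (p * s ≤_) (*-identityʳ p) (*-monoˡ-≤-nonNeg p {{nonNegative 0≤p}} s≤1)) p≤1

≤1-^ : ∀ {p} k → 0ℚ ≤ p → p ≤ 1ℚ → p ^ k ≤ 1ℚ
≤1-^ zero 0≤p p≤1 = ≤-refl
≤1-^ (suc k) 0≤p p≤1 = ≤1-* 0≤p p≤1 (≤1-^ k 0≤p p≤1)

part≤1 : ∀ A B I → 0ℚ ≤ B → 0ℚ ≤ I → (A + B) * I ≡ 1ℚ → A * I ≤ 1ℚ
part≤1 A B I 0≤B 0≤I eq = gap⇒≤ (0≤* 0≤B 0≤I) (trans (sym eq) (*-distribʳ-+ I A B))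

-- 1/X - 1/(D + X) = D · 1/X · 1/(D + X), stated for I = 1/X and J = 1/(D + X).
reciprocal-gap : ∀ I J D X → X * I ≡ 1ℚ → (D + X) * J ≡ 1ℚ → I ≡ J + D * I * J
reciprocal-gap I J D X XI≡1 DXJ≡1 = begin
  I                            ≡⟨ sym (*-identityʳ I) ⟩
  I * 1ℚ                       ≡⟨ cong (I *_) (sym DXJ≡1) ⟩
  I * ((D + X) * J)            ≡⟨ solve 4 (λ I J D X → I :* ((D :+ X) :* J) := D :* I :* J :+ (X :* I) :* J) refl I J D X ⟩
  D * I * J + (X * I) * J      ≡⟨ cong (λ z → D * I * J + z * J) XI≡1 ⟩
  D * I * J + 1ℚ * J           ≡⟨ solve 3 (λ I J D → D :* I :* J :+ con 1ℚ :* J := J :+ D :* I :* J) refl I J D ⟩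
  J + D * I * J                ∎
  where open ≡-Reasoning

recip-antitone : ∀ {a b} → a ℕ.≤ b → recip b ≤ recip a
recip-antitone {a} {b} a≤b = subst (λ z → recip z ≤ recip a) (ℕ.m∸n+n≡m a≤b) (shifted (b ℕ.∸ a))
  where
  denominator : ∀ d → (ι d + ι (suc a)) * recip (d ℕ.+ a) ≡ 1ℚ
  denominator d = trans (cong (_* recip (d ℕ.+ a)) (sym (trans (cong ι (sym (ℕ.+-suc d a))) (ι-+ d (suc a)))))
    (ι-recip (d ℕ.+ a))
  shifted : ∀ d → recip (d ℕ.+ a) ≤ recip a
  shifted d = gap⇒≤ (0≤* (0≤* (0≤ι d) (0≤recip a)) (0≤recip (d ℕ.+ a)))
    (reciprocal-gap (recip a) (recip (d ℕ.+ a)) (ι d) (ι (suc a)) (ι-recip a) (denominator d))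

recip≤1 : ∀ b → recip b ≤ 1ℚ
recip≤1 b = recip-antitone {0} {b} z≤n

recip-difference : ∀ t → recip t - recip (suc t) ≡ recip t * recip (suc t)
recip-difference t = begin
  recip t - recip (suc t)
    ≡⟨ cong (_- recip (suc t)) (reciprocal-gap (recip t) (recip (suc t)) 1ℚ (ι (suc t)) (ι-recip t)
         (trans (cong (_* recip (suc t)) (sym (ι-suc (suc t)))) (ι-recip (suc t)))) ⟩
  (recip (suc t) + 1ℚ * recip t * recip (suc t)) - recip (suc t)
    ≡⟨ solve 2 (λ a b → (b :+ con 1ℚ :* a :* b) :- b := a :* b) refl (recip t) (recip (suc t)) ⟩
  recip t * recip (suc t) ∎
  where open ≡-Reasoning

sumTo : (ℕ → ℚ) → ℕ → ℚ
sumTo f zero = 0ℚ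
sumTo f (suc n) = sumTo f n + f (suc n)

sumTo-cong : ∀ {f g} n → (∀ m → m ℕ.< n → f (suc m) ≡ g (suc m)) → sumTo f n ≡ sumTo g n
sumTo-cong zero f≡g = refl
sumTo-cong (suc n) f≡g =
  cong₂ _+_ (sumTo-cong n (λ m m<n → f≡g m (ℕ.m<n⇒m<1+n m<n))) (f≡g n (ℕ.n<1+n n))

sumTo-+ : ∀ f g n → sumTo (λ m → f m + g m) n ≡ sumTo f n + sumTo g n
sumTo-+ f g zero = refl
sumTo-+ f g (suc n) = trans (cong (_+ (f (suc n) + g (suc n))) (sumTo-+ f g n))
  (solve 4 (λ a b c d → (a :+ b) :+ (c :+ d) := (a :+ c) :+ (b :+ d)) refl
    (sumTo f n) (sumTo g n) (f (suc n)) (g (suc n)))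

sumTo-scale : ∀ c f n → sumTo (λ m → c * f m) n ≡ c * sumTo f n
sumTo-scale c f zero = sym (*-zeroʳ c)
sumTo-scale c f (suc n) =
  trans (cong (_+ (c * f (suc n))) (sumTo-scale c f n)) (sym (*-distribˡ-+ c (sumTo f n) (f (suc n))))

sumTo-zero : ∀ n → sumTo (λ _ → 0ℚ) n ≡ 0ℚ
sumTo-zero zero = refl
sumTo-zero (suc n) = trans (+-identityʳ _) (sumTo-zero n)

sumTo-mono : ∀ {f g} n → (∀ m → m ℕ.< n → f (suc m) ≤ g (suc m)) → sumTo f n ≤ sumTo g n
sumTo-mono zero f≤g = ≤-refl
sumTo-mono (suc n) f≤g =
  +-mono-≤ (sumTo-mono n (λ m m<n → f≤g m (ℕ.m<n⇒m<1+n m<n))) (f≤g n (ℕ.n<1+n n))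

sumTo-abs : ∀ f n → ∣ sumTo f n ∣ ≤ sumTo (λ m → ∣ f m ∣) n
sumTo-abs f zero = ≤-refl
sumTo-abs f (suc n) =
  ≤-trans (∣p+q∣≤∣p∣+∣q∣ (sumTo f n) (f (suc n))) (+-monoˡ-≤ ∣ f (suc n) ∣ (sumTo-abs f n))

sumTo-block-mono : ∀ {f g} → (∀ m → f (suc m) ≤ g (suc m)) →
  ∀ {a b} → a ℕ.≤ b → sumTo f b - sumTo f a ≤ sumTo g b - sumTo g a
sumTo-block-mono {f} {g} f≤g {a} {b} a≤b =
  subst (λ z → F z - F a ≤ G z - G a) (ℕ.m∸n+n≡m a≤b) (blocks (b ℕ.∸ a))
  where
  F = sumTo f
  G = sumTo g
  rearrange : ∀ p q r → (p + q) - r ≡ (p - r) + q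
  rearrange = solve 3 (λ p q r → (p :+ q) :- r := (p :- r) :+ q) refl
  blocks : ∀ d → F (d ℕ.+ a) - F a ≤ G (d ℕ.+ a) - G a
  blocks zero = ≤-reflexive (trans (+-inverseʳ (F a)) (sym (+-inverseʳ (G a))))
  blocks (suc d) = begin
    (F (d ℕ.+ a) + f (suc (d ℕ.+ a))) - F a ≡⟨ rearrange (F (d ℕ.+ a)) (f (suc (d ℕ.+ a))) (F a) ⟩
    (F (d ℕ.+ a) - F a) + f (suc (d ℕ.+ a)) ≤⟨ +-mono-≤ (blocks d) (f≤g (d ℕ.+ a)) ⟩
    (G (d ℕ.+ a) - G a) + g (suc (d ℕ.+ a)) ≡⟨ sym (rearrange (G (d ℕ.+ a)) (g (suc (d ℕ.+ a))) (G a)) ⟩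
    (G (d ℕ.+ a) + g (suc (d ℕ.+ a))) - G a ∎
    where open ≤-Reasoning

sumℚ-++ : ∀ xs ys → sumℚ (xs ++ ys) ≡ sumℚ xs + sumℚ ys
sumℚ-++ [] ys = sym (+-identityˡ _)
sumℚ-++ (p ∷ ps) qs = trans (cong (λ z → p + z) (sumℚ-++ ps qs)) (sym (+-assoc p _ _))

sumℚ-range1 : ∀ f n → sumℚ (map f (range1 n)) ≡ sumTo f n
sumℚ-range1 f zero = refl
sumℚ-range1 f (suc n) = begin
  sumℚ (map f (range1 n ++ [ suc n ]))        ≡⟨ cong sumℚ (map-++ f (range1 n) [ suc n ]) ⟩
  sumℚ (map f (range1 n) ++ [ f (suc n) ])    ≡⟨ sumℚ-++ (map f (range1 n)) _ ⟩
  sumℚ (map f (range1 n)) + (f (suc n) + 0ℚ) ≡⟨ cong₂ _+_ (sumℚ-range1 f n) (+-identityʳ _) ⟩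
  sumTo f n + f (suc n)                       ∎
  where open ≡-Reasoning

sumℚ-concatMap : ∀ {A B : Set} (F : B → ℚ) (g : A → List B) as →
  sumℚ (map F (concatMap g as)) ≡ sumℚ (map (λ a → sumℚ (map F (g a))) as)
sumℚ-concatMap F g [] = refl
sumℚ-concatMap F g (a ∷ as) = begin
  sumℚ (map F (g a ++ concatMap g as))                ≡⟨ cong sumℚ (map-++ F (g a) (concatMap g as)) ⟩
  sumℚ (map F (g a) ++ map F (concatMap g as))        ≡⟨ sumℚ-++ (map F (g a)) _ ⟩
  sumℚ (map F (g a)) + sumℚ (map F (concatMap g as))  ≡⟨ cong (λ z → sumℚ (map F (g a)) + z) (sumℚ-concatMap F g as) ⟩
  sumℚ (map F (g a)) + sumℚ (map (λ a → sumℚ (map F (g a))) as) ∎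
  where open ≡-Reasoning

-- x m = 1/m² (and x 0 = 0), the variables of the symmetric polynomial H.
x : ℕ → ℚ
x = invPow 2

invPow-recip : ∀ e m → invPow e (suc m) ≡ recip m ^ e
invPow-recip zero m = refl
invPow-recip (suc e) m = sym (begin
  recip m * recip m ^ e          ≡⟨ cong (recip m *_) (sym (invPow-recip e m)) ⟩
  recip m * invPow e (suc m)     ≡⟨ fraction-* (+ 1) (suc m) (+ 1) (suc m ℕ.^ e) {{_}} {{ℕ.m^n≢0 (suc m) e}} ⟩
  invPow (suc e) (suc m)         ∎)
  where open ≡-Reasoning

x-suc : ∀ m → x (suc m) ≡ recip m ^ 2
x-suc = invPow-recip 2

x-* : ∀ a b → x (a ℕ.* b) ≡ x a * x b
x-* zero b = sym (*-zeroˡ (x b))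
x-* (suc a) zero rewrite ℕ.*-zeroʳ a = sym (*-zeroʳ (x (suc a)))
x-* (suc a) (suc b) = begin
  x (suc a ℕ.* suc b)             ≡⟨ x-suc (b ℕ.+ a ℕ.* suc b) ⟩
  recip (b ℕ.+ a ℕ.* suc b) ^ 2   ≡⟨ cong (_^ 2) (sym (fraction-* (+ 1) (suc a) (+ 1) (suc b))) ⟩
  (recip a * recip b) ^ 2         ≡⟨ solve 2 (λ u v → (u :* v) :* ((u :* v) :* con 1ℚ) := (u :* (u :* con 1ℚ)) :* (v :* (v :* con 1ℚ))) refl (recip a) (recip b) ⟩
  recip a ^ 2 * recip b ^ 2       ≡⟨ cong₂ _*_ (sym (x-suc a)) (sym (x-suc b)) ⟩
  x (suc a) * x (suc b)           ∎
  where open ≡-Reasoning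

0≤x : ∀ m → 0ℚ ≤ x m
0≤x zero = ≤-refl
0≤x (suc m) = subst (0ℚ ≤_) (sym (x-suc m)) (0≤^ 2 (0≤recip m))

x≤1 : ∀ m → x m ≤ 1ℚ
x≤1 zero = 0≤1
x≤1 (suc m) = subst (_≤ 1ℚ) (sym (x-suc m)) (≤1-^ 2 (0≤recip m) (recip≤1 m))

-- Splitting partitions by their largest part m:  H (k+1) n = Σ_{m ≤ n} x_m · H k m.
zetaPPartial-suc : ∀ k n → zetaPPartial (suc k) n ≡ sumTo (λ m → x m * zetaPPartial k m) n
zetaPPartial-suc k n =
  trans (sumℚ-concatMap weight (λ m → map (m ∷_) (partitionsBounded k m)) (range1 n))
  (trans (cong sumℚ (map-cong (λ m → prepend m (partitionsBounded k m)) (range1 n)))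
         (sumℚ-range1 _ n))
  where
  weight : List ℕ → ℚ
  weight λs = invPow 2 (product λs)
  prepend : ∀ m P → sumℚ (map weight (map (m ∷_) P)) ≡ x m * sumℚ (map weight P)
  prepend m [] = sym (*-zeroʳ (x m))
  prepend m (λs ∷ P) =
    trans (cong₂ _+_ (x-* m (product λs)) (prepend m P)) (sym (*-distribˡ-+ (x m) _ _))

zetaPartial-even : ∀ K n → zetaPartial (2 ℕ.* K) n ≡ sumTo (λ m → x m ^ K) n
zetaPartial-even K n = trans (sumℚ-range1 (invPow (2 ℕ.* K)) n) (sumTo-cong n (λ m _ → begin
  invPow (2 ℕ.* K) (suc m)  ≡⟨ invPow-recip (2 ℕ.* K) m ⟩
  recip m ^ (2 ℕ.* K)       ≡⟨ ^-*-assoc (recip m) 2 K ⟩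
  (recip m ^ 2) ^ K         ≡⟨ cong (_^ K) (sym (x-suc m)) ⟩
  x (suc m) ^ K             ∎))
  where open ≡-Reasoning

-- T n m = Π_{i<m} (n-i)/(n+1+i) = n!² / ((n-m)! (n+m)!), the modulus of the
-- partial-fraction coefficients.
T : ℕ → ℕ → ℚ
T n zero = 1ℚ
T n (suc m) = T n m * ι (n ℕ.∸ m) * recip (n ℕ.+ m)

-- The algebra behind one factor of T (for a = n - m, M = m, N = n): with N = a + M and
-- I = 1/(1 + N + M),
-- if t ∈ [0,1] and (1 - t)·N ≤ M², then t·a·I ∈ [0,1] and (1 - t·a·I)·N ≤ (1 + M)².
-- N and X are passed with their defining equations so the ring solver sees free variables.
T-bounds-step : ∀ t a M N X I → N ≡ a + M → X ≡ 1ℚ + (N + M) → X * I ≡ 1ℚ →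
  0ℚ ≤ a → 0ℚ ≤ M → 0ℚ ≤ I → 0ℚ ≤ t → t ≤ 1ℚ → (1ℚ - t) * N ≤ M * M →
  (0ℚ ≤ t * a * I) × (t * a * I ≤ 1ℚ) × ((1ℚ - t * a * I) * N ≤ (1ℚ + M) * (1ℚ + M))
T-bounds-step t a M _ _ I refl refl XI≡1 0≤a 0≤M 0≤I 0≤t t≤1 gap =
  0≤* (0≤* 0≤t 0≤a) 0≤I , t′≤1 , gap′
  where
  N = a + M
  t′ = t * a * I
  0≤1+2M : 0ℚ ≤ 1ℚ + (M + M)
  0≤1+2M = 0≤+ 0≤1 (0≤+ 0≤M 0≤M)
  -- a·I and N·I are parts of X·I = 1
  aI≤1 : a * I ≤ 1ℚ
  aI≤1 = part≤1 a (1ℚ + (M + M)) I 0≤1+2M 0≤I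
    (trans (cong (_* I) (solve 2 (λ a M → a :+ (con 1ℚ :+ (M :+ M)) := con 1ℚ :+ ((a :+ M) :+ M)) refl a M)) XI≡1)
  NI≤1 : N * I ≤ 1ℚ
  NI≤1 = part≤1 N (1ℚ + M) I (0≤+ 0≤1 0≤M) 0≤I
    (trans (cong (_* I) (solve 2 (λ a M → (a :+ M) :+ (con 1ℚ :+ M) := con 1ℚ :+ ((a :+ M) :+ M)) refl a M)) XI≡1)
  t′≤1 : t′ ≤ 1ℚ
  t′≤1 = subst (_≤ 1ℚ) (sym (*-assoc t a I)) (≤1-* 0≤t t≤1 aI≤1)
  -- 1 - t·a·I = (1 - t) + t·(1 + 2M)·I, because a = X - (1 + 2M) and X·I = 1
  split : (1ℚ - t′) * N ≡ (1ℚ - t) * N + t * (N * I) * (1ℚ + (M + M))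
  split = begin
    (1ℚ - t′) * N
      ≡⟨ solve 2 (λ u v → u := u :+ v :* (con 1ℚ :- con 1ℚ)) refl ((1ℚ - t′) * N) (t * N) ⟩
    (1ℚ - t′) * N + t * N * (1ℚ - 1ℚ)
      ≡⟨ cong (λ z → (1ℚ - t′) * N + t * N * (z - 1ℚ)) (sym XI≡1) ⟩
    (1ℚ - t′) * N + t * N * ((1ℚ + (N + M)) * I - 1ℚ)
      ≡⟨ solve 4 (λ t a M I →
           (con 1ℚ :- t :* a :* I) :* (a :+ M) :+ t :* (a :+ M) :* ((con 1ℚ :+ ((a :+ M) :+ M)) :* I :- con 1ℚ)
           := (con 1ℚ :- t) :* (a :+ M) :+ t :* ((a :+ M) :* I) :* (con 1ℚ :+ (M :+ M))) refl t a M I ⟩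
    (1ℚ - t) * N + t * (N * I) * (1ℚ + (M + M)) ∎
    where open ≡-Reasoning
  gap′ : (1ℚ - t′) * N ≤ (1ℚ + M) * (1ℚ + M)
  gap′ = begin
    (1ℚ - t′) * N                                   ≡⟨ split ⟩
    (1ℚ - t) * N + t * (N * I) * (1ℚ + (M + M))     ≤⟨ +-mono-≤ gap (≤1-*ˡ 0≤1+2M (≤1-* 0≤t t≤1 NI≤1)) ⟩
    M * M + (1ℚ + (M + M))                          ≡⟨ solve 1 (λ M → M :* M :+ (con 1ℚ :+ (M :+ M)) := (con 1ℚ :+ M) :* (con 1ℚ :+ M)) refl M ⟩
    (1ℚ + M) * (1ℚ + M)                             ∎
    where open ≤-Reasoning

T-bounds : ∀ n m → m ℕ.≤ n → (0ℚ ≤ T n m) × (T n m ≤ 1ℚ) × ((1ℚ - T n m) * ι n ≤ ι m * ι m)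
T-bounds n zero _ = 0≤1 , ≤-refl ,
  ≤-reflexive (solve 1 (λ N → (con 1ℚ :- con 1ℚ) :* N := con 0ℚ :* con 0ℚ) refl (ι n))
T-bounds n (suc m) m<n with T-bounds n m (ℕ.<⇒≤ m<n)
... | 0≤T , T≤1 , gap =
  let 0≤T′ , T′≤1 , gap′ = T-bounds-step (T n m) (ι (n ℕ.∸ m)) (ι m) (ι n) (ι (suc (n ℕ.+ m)))
        (recip (n ℕ.+ m)) (ι-∸ n m (ℕ.<⇒≤ m<n)) (trans (ι-suc (n ℕ.+ m)) (cong (λ z → 1ℚ + z) (ι-+ n m)))
        (ι-recip (n ℕ.+ m)) (0≤ι (n ℕ.∸ m)) (0≤ι m) (0≤recip (n ℕ.+ m)) 0≤T T≤1 gap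
  in 0≤T′ , T′≤1 , subst (λ z → (1ℚ - T n (suc m)) * ι n ≤ z * z) (sym (ι-suc m)) gap′

-- The algebra of T-shift below (for a = n - m, M = m, N = n + 1): with N = 1 + a + M, I₁ = 1/(N + M) and I₂ = 1/(1 + N + M),
-- the identity T₁(N² - M²) = T₀N² survives multiplying T₁, T₀ by their next factors.
T-shift-step : ∀ a M T₁ T₀ I₁ I₂ N A X₁ X₂ M′ →
  N ≡ 1ℚ + (a + M) → A ≡ 1ℚ + a → X₁ ≡ 1ℚ + ((a + M) + M) → X₂ ≡ 1ℚ + X₁ → M′ ≡ 1ℚ + M →
  X₁ * I₁ ≡ 1ℚ → X₂ * I₂ ≡ 1ℚ → T₁ * (N * N - M * M) ≡ T₀ * (N * N) →
  T₁ * A * I₂ * (N * N - M′ * M′) ≡ T₀ * a * I₁ * (N * N)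
T-shift-step a M T₁ T₀ I₁ I₂ _ _ _ _ _ refl refl refl refl refl X₁I₁≡1 X₂I₂≡1 shift = begin
  T₁ * (1ℚ + a) * I₂ * (N * N - (1ℚ + M) * (1ℚ + M))
    ≡⟨ solve 4 (λ a M T₁ I₂ →
         T₁ :* (con 1ℚ :+ a) :* I₂ :* ((con 1ℚ :+ (a :+ M)) :* (con 1ℚ :+ (a :+ M)) :- (con 1ℚ :+ M) :* (con 1ℚ :+ M))
         := T₁ :* (con 1ℚ :+ a) :* a :* ((con 1ℚ :+ (con 1ℚ :+ ((a :+ M) :+ M))) :* I₂)) refl a M T₁ I₂ ⟩
  T₁ * (1ℚ + a) * a * ((1ℚ + (1ℚ + ((a + M) + M))) * I₂) ≡⟨ cong (λ z → T₁ * (1ℚ + a) * a * z) X₂I₂≡1 ⟩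
  T₁ * (1ℚ + a) * a * 1ℚ                                  ≡⟨ cong (λ z → T₁ * (1ℚ + a) * a * z) (sym X₁I₁≡1) ⟩
  T₁ * (1ℚ + a) * a * ((1ℚ + ((a + M) + M)) * I₁)
    ≡⟨ solve 4 (λ a M T₁ I₁ →
         T₁ :* (con 1ℚ :+ a) :* a :* ((con 1ℚ :+ ((a :+ M) :+ M)) :* I₁)
         := a :* I₁ :* (T₁ :* ((con 1ℚ :+ (a :+ M)) :* (con 1ℚ :+ (a :+ M)) :- M :* M))) refl a M T₁ I₁ ⟩
  a * I₁ * (T₁ * (N * N - M * M))                         ≡⟨ cong (λ z → a * I₁ * z) shift ⟩
  a * I₁ * (T₀ * (N * N))                                 ≡⟨ solve 4 (λ a I₁ T₀ N → a :* I₁ :* (T₀ :* (N :* N)) := T₀ :* a :* I₁ :* (N :* N)) refl a I₁ T₀ N ⟩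
  T₀ * a * I₁ * (N * N)                                   ∎
  where
  open ≡-Reasoning
  N = 1ℚ + (a + M)

T-shift : ∀ n m → m ℕ.≤ suc n →
  T (suc n) m * (ι (suc n) * ι (suc n) - ι m * ι m) ≡ T n m * (ι (suc n) * ι (suc n))
T-shift n zero _ = solve 1 (λ N → con 1ℚ :* (N :* N :- con 0ℚ :* con 0ℚ) := con 1ℚ :* (N :* N)) refl (ι (suc n))
T-shift n (suc m) (s≤s m≤n) =
  T-shift-step (ι (n ℕ.∸ m)) (ι m) (T (suc n) m) (T n m) (recip (n ℕ.+ m)) (recip (suc n ℕ.+ m))
    (ι (suc n)) (ι (suc n ℕ.∸ m)) (ι (suc (n ℕ.+ m))) (ι (suc (suc n ℕ.+ m))) (ι (suc m))
    N≡ A≡ X₁≡ (ι-suc (suc n ℕ.+ m)) (ι-suc m) (ι-recip (n ℕ.+ m)) (ι-recip (suc n ℕ.+ m))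
    (T-shift n m (ℕ.m≤n⇒m≤1+n m≤n))
  where
  n≡ : ι n ≡ ι (n ℕ.∸ m) + ι m
  n≡ = ι-∸ n m m≤n
  N≡ : ι (suc n) ≡ 1ℚ + (ι (n ℕ.∸ m) + ι m)
  N≡ = trans (ι-suc n) (cong (λ z → 1ℚ + z) n≡)
  A≡ : ι (suc n ℕ.∸ m) ≡ 1ℚ + ι (n ℕ.∸ m)
  A≡ = trans (cong ι (ℕ.+-∸-assoc 1 m≤n)) (ι-suc (n ℕ.∸ m))
  X₁≡ : ι (suc (n ℕ.+ m)) ≡ 1ℚ + ((ι (n ℕ.∸ m) + ι m) + ι m)
  X₁≡ = trans (ι-suc (n ℕ.+ m)) (cong (λ z → 1ℚ + z) (trans (ι-+ n m) (cong (_+ ι m) n≡)))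

divide-by-squares : ∀ T₁ T₀ I J M N → M * I ≡ 1ℚ → N * J ≡ 1ℚ →
  T₁ * (N * N - M * M) ≡ T₀ * (N * N) → T₁ * (I ^ 2 - J ^ 2) ≡ T₀ * I ^ 2
divide-by-squares T₁ T₀ I J M N MI≡1 NJ≡1 shift = begin
  T₁ * (I ^ 2 - J ^ 2)
    ≡⟨ solve 3 (λ T₁ I J → T₁ :* (I :* (I :* con 1ℚ) :- J :* (J :* con 1ℚ)) := T₁ :* (con 1ℚ :* con 1ℚ :* (I :* I) :- con 1ℚ :* con 1ℚ :* (J :* J))) refl T₁ I J ⟩
  T₁ * (1ℚ * 1ℚ * (I * I) - 1ℚ * 1ℚ * (J * J))
    ≡⟨ cong₂ (λ u v → T₁ * (u * u * (I * I) - v * v * (J * J))) (sym NJ≡1) (sym MI≡1) ⟩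
  T₁ * ((N * J) * (N * J) * (I * I) - (M * I) * (M * I) * (J * J))
    ≡⟨ solve 5 (λ T₁ I J M N → T₁ :* ((N :* J) :* (N :* J) :* (I :* I) :- (M :* I) :* (M :* I) :* (J :* J)) := (T₁ :* (N :* N :- M :* M)) :* (I :* I) :* (J :* J)) refl T₁ I J M N ⟩
  (T₁ * (N * N - M * M)) * (I * I) * (J * J)  ≡⟨ cong (λ z → z * (I * I) * (J * J)) shift ⟩
  (T₀ * (N * N)) * (I * I) * (J * J)
    ≡⟨ solve 4 (λ T₀ I J N → (T₀ :* (N :* N)) :* (I :* I) :* (J :* J) := T₀ :* (I :* (I :* con 1ℚ)) :* ((N :* J) :* (N :* J))) refl T₀ I J N ⟩
  T₀ * I ^ 2 * ((N * J) * (N * J))            ≡⟨ cong (λ z → T₀ * I ^ 2 * (z * z)) NJ≡1 ⟩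
  T₀ * I ^ 2 * (1ℚ * 1ℚ)                      ≡⟨ solve 2 (λ T₀ I → T₀ :* (I :* (I :* con 1ℚ)) :* (con 1ℚ :* con 1ℚ) := T₀ :* (I :* (I :* con 1ℚ))) refl T₀ I ⟩
  T₀ * I ^ 2                                  ∎
  where open ≡-Reasoning

T-shift-x : ∀ n m → m ℕ.≤ n → T (suc n) (suc m) * (x (suc m) - x (suc n)) ≡ T n (suc m) * x (suc m)
T-shift-x n m m≤n rewrite x-suc m | x-suc n =
  divide-by-squares (T (suc n) (suc m)) (T n (suc m)) (recip m) (recip n) (ι (suc m)) (ι (suc n))
    (ι-recip m) (ι-recip n) (T-shift n (suc m) (s≤s m≤n))

sign : ℕ → ℚ
sign zero = 1ℚ
sign (suc m) = - sign m

∣sign∣ : ∀ m → ∣ sign m ∣ ≡ 1ℚ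
∣sign∣ zero = refl
∣sign∣ (suc m) = trans (∣-p∣≡∣p∣ (sign m)) (∣sign∣ m)

two : ℚ
two = 1ℚ + 1ℚ

0≤two : 0ℚ ≤ two
0≤two = 0≤+ 0≤1 0≤1

B : ℕ → ℕ → ℚ
B n zero = 0ℚ
B n (suc m) = two * sign m * T n (suc m)

Q : ℕ → ℕ → ℚ
Q k n = sumTo (λ m → B n m * x m ^ k) n

B-shift : ∀ n m → m ℕ.≤ n → B (suc n) (suc m) * (x (suc m) - x (suc n)) ≡ B n (suc m) * x (suc m)
B-shift n m m≤n = begin
  c * T (suc n) (suc m) * (x (suc m) - x (suc n))   ≡⟨ *-assoc c _ _ ⟩
  c * (T (suc n) (suc m) * (x (suc m) - x (suc n))) ≡⟨ cong (c *_) (T-shift-x n m m≤n) ⟩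
  c * (T n (suc m) * x (suc m))                     ≡⟨ sym (*-assoc c _ _) ⟩
  c * T n (suc m) * x (suc m)                       ∎
  where
  open ≡-Reasoning
  c = two * sign m

Q-step : ∀ k n → Q (suc k) (suc n) ≡ Q (suc k) n + x (suc n) * Q k (suc n)
Q-step k n = begin
  sumTo f₁ n + f₁ (suc n)                      ≡⟨ cong (_+ f₁ (suc n)) (sumTo-cong n (λ m m<n → term m (ℕ.<⇒≤ m<n))) ⟩
  sumTo (λ m → f₀ m + xN * g m) n + f₁ (suc n) ≡⟨ cong (_+ f₁ (suc n)) (sumTo-+ f₀ (λ m → xN * g m) n) ⟩
  (sumTo f₀ n + sumTo (λ m → xN * g m) n) + f₁ (suc n)
                                               ≡⟨ cong (λ z → (sumTo f₀ n + z) + f₁ (suc n)) (sumTo-scale xN g n) ⟩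
  (sumTo f₀ n + xN * sumTo g n) + f₁ (suc n)
    ≡⟨ solve 5 (λ a b c B₁ P → (a :+ c :* b) :+ B₁ :* (c :* P) := a :+ c :* (b :+ B₁ :* P)) refl
         (sumTo f₀ n) (sumTo g n) xN (B (suc n) (suc n)) (x (suc n) ^ k) ⟩
  sumTo f₀ n + xN * (sumTo g n + g (suc n))    ∎
  where
  open ≡-Reasoning
  xN = x (suc n)
  f₁ f₀ g : ℕ → ℚ
  f₁ m = B (suc n) m * x m ^ suc k
  f₀ m = B n m * x m ^ suc k
  g m = B (suc n) m * x m ^ k
  -- multiply B-shift by x_{m+1}^k
  term : ∀ m → m ℕ.≤ n → f₁ (suc m) ≡ f₀ (suc m) + xN * g (suc m)
  term m m≤n = begin
    B₁ * (X * P)                        ≡⟨ solve 4 (λ B₁ X xN P → B₁ :* (X :* P) := (B₁ :* (X :- xN)) :* P :+ xN :* (B₁ :* P)) refl B₁ X xN P ⟩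
    (B₁ * (X - xN)) * P + xN * (B₁ * P) ≡⟨ cong (λ z → z * P + xN * (B₁ * P)) (B-shift n m m≤n) ⟩
    (B₀ * X) * P + xN * (B₁ * P)        ≡⟨ cong (_+ xN * (B₁ * P)) (*-assoc B₀ X P) ⟩
    B₀ * (X * P) + xN * (B₁ * P)        ∎
    where
    B₁ = B (suc n) (suc m)
    B₀ = B n (suc m)
    X = x (suc m)
    P = x (suc m) ^ k

-- The algebra of B-sum below (for b = n - j - 1, J = j, N = n): one more term, with
-- N = (1 + b) + J, a = 1 + b and I = 1/(1 + N + J).
B-sum-step : ∀ N J b s t I X S a → N ≡ (1ℚ + b) + J → a ≡ 1ℚ + b → X ≡ 1ℚ + (N + J) → X * I ≡ 1ℚ →
  N * S ≡ N - s * t * a → N * (S + two * s * (t * a * I)) ≡ N - (- s) * (t * a * I) * b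
B-sum-step _ J b s t I _ S _ refl refl refl XI≡1 sum = begin
  N * (S + two * s * (t * a * I))                    ≡⟨ *-distribˡ-+ N S _ ⟩
  N * S + N * (two * s * (t * a * I))                ≡⟨ cong (_+ N * (two * s * (t * a * I))) sum ⟩
  (N - s * t * a) + N * (two * s * (t * a * I))
    ≡⟨ solve 5 (λ J b s t I →
         ((con 1ℚ :+ b) :+ J :- s :* t :* (con 1ℚ :+ b)) :+ ((con 1ℚ :+ b) :+ J) :* ((con 1ℚ :+ con 1ℚ) :* s :* (t :* (con 1ℚ :+ b) :* I))
         := ((con 1ℚ :+ b) :+ J :- (:- s) :* (t :* (con 1ℚ :+ b) :* I) :* b) :+ s :* t :* (con 1ℚ :+ b) :* ((con 1ℚ :+ (((con 1ℚ :+ b) :+ J) :+ J)) :* I :- con 1ℚ))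
         refl J b s t I ⟩
  (N - (- s) * (t * a * I) * b) + s * t * a * (X * I - 1ℚ)
                                                     ≡⟨ cong (λ z → (N - (- s) * (t * a * I) * b) + s * t * a * (z - 1ℚ)) XI≡1 ⟩
  (N - (- s) * (t * a * I) * b) + s * t * a * (1ℚ - 1ℚ)
    ≡⟨ solve 4 (λ w s t a → w :+ s :* t :* a :* (con 1ℚ :- con 1ℚ) := w) refl (N - (- s) * (t * a * I) * b) s t a ⟩
  N - (- s) * (t * a * I) * b                        ∎
  where
  open ≡-Reasoning
  N = (1ℚ + b) + J
  a = 1ℚ + b
  X = 1ℚ + (N + J)

B-sum : ∀ n j → j ℕ.≤ n → ι n * sumTo (B n) j ≡ ι n - sign j * T n j * ι (n ℕ.∸ j)
B-sum n zero _ = solve 1 (λ N → N :* con 0ℚ := N :- con 1ℚ :* con 1ℚ :* N) refl (ι n)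
B-sum n (suc j) j<n =
  B-sum-step (ι n) (ι j) (ι (n ℕ.∸ suc j)) (sign j) (T n j) (recip (n ℕ.+ j)) (ι (suc (n ℕ.+ j)))
    (sumTo (B n) j) (ι (n ℕ.∸ j)) N≡ a≡ (trans (ι-suc (n ℕ.+ j)) (cong (λ z → 1ℚ + z) (ι-+ n j)))
    (ι-recip (n ℕ.+ j)) (B-sum n j (ℕ.<⇒≤ j<n))
  where
  a≡ : ι (n ℕ.∸ j) ≡ 1ℚ + ι (n ℕ.∸ suc j)
  a≡ = trans (cong ι (ℕ.+-∸-assoc 1 j<n)) (ι-suc (n ℕ.∸ suc j))
  N≡ : ι n ≡ (1ℚ + ι (n ℕ.∸ suc j)) + ι j
  N≡ = trans (ι-∸ n j (ℕ.<⇒≤ j<n)) (cong (_+ ι j) a≡)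

Q-zero : ∀ n → Q 0 (suc n) ≡ 1ℚ
Q-zero n = begin
  Q 0 (suc n)                    ≡⟨ sumTo-cong (suc n) (λ m _ → *-identityʳ (B (suc n) (suc m))) ⟩
  s                              ≡⟨ solve 3 (λ s N I → s := (N :* s) :* I :+ s :* (con 1ℚ :- N :* I)) refl s N (recip n) ⟩
  (N * s) * recip n + s * (1ℚ - N * recip n)
                                 ≡⟨ cong₂ (λ u v → u * recip n + s * (1ℚ - v)) full (ι-recip n) ⟩
  N * recip n + s * (1ℚ - 1ℚ)    ≡⟨ cong₂ (λ u v → u + s * v) (ι-recip n) (+-inverseʳ 1ℚ) ⟩
  1ℚ + s * 0ℚ                    ≡⟨ solve 1 (λ s → con 1ℚ :+ s :* con 0ℚ := con 1ℚ) refl s ⟩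
  1ℚ                             ∎
  where
  open ≡-Reasoning
  N = ι (suc n)
  s = sumTo (B (suc n)) (suc n)
  full : N * s ≡ N
  full = trans (B-sum (suc n) (suc n) ℕ.≤-refl)
    (trans (cong (λ z → N - sign (suc n) * T (suc n) (suc n) * ι z) (ℕ.n∸n≡0 (suc n)))
      (solve 2 (λ N u → N :- u :* con 0ℚ := N) refl N (sign (suc n) * T (suc n) (suc n))))

-- The partial-fraction identity  h_k(x_1, …, x_n) = Σ_{m ≤ n} B n m · x_m^k  (k ≥ 1 or n ≥ 1):
-- both sides satisfy the same recursion with the same initial values.
partialFraction : ∀ k n → zetaPPartial (suc k) n ≡ Q (suc k) n
partialFraction-pos : ∀ k n → zetaPPartial k (suc n) ≡ Q k (suc n)

partialFraction k zero = refl
partialFraction k (suc n) = partialFraction-pos (suc k) n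

partialFraction-pos zero n = sym (Q-zero n)
partialFraction-pos (suc k) n = begin
  zetaPPartial (suc k) (suc n)                           ≡⟨ zetaPPartial-suc k (suc n) ⟩
  sumTo (λ m → x m * zetaPPartial k m) n + x (suc n) * zetaPPartial k (suc n)
                                                         ≡⟨ cong (_+ x (suc n) * zetaPPartial k (suc n)) (sym (zetaPPartial-suc k n)) ⟩
  zetaPPartial (suc k) n + x (suc n) * zetaPPartial k (suc n)
                                                         ≡⟨ cong₂ (λ u v → u + x (suc n) * v) (partialFraction k n) (partialFraction-pos k n) ⟩
  Q (suc k) n + x (suc n) * Q k (suc n)                  ≡⟨ sym (Q-step k n) ⟩
  Q (suc k) (suc n)                                      ∎
  where open ≡-Reasoning

x≤recip-difference : ∀ t → x (suc (suc t)) ≤ recip t - recip (suc t)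
x≤recip-difference t = begin
  x (suc (suc t))                 ≡⟨ trans (x-suc (suc t)) (cong (recip (suc t) *_) (*-identityʳ (recip (suc t)))) ⟩
  recip (suc t) * recip (suc t)   ≤⟨ *-monoʳ-≤-nonNeg (recip (suc t)) {{nonNegative (0≤recip (suc t))}} (recip-antitone (ℕ.n≤1+n t)) ⟩
  recip t * recip (suc t)         ≡⟨ sym (recip-difference t) ⟩
  recip t - recip (suc t)         ∎
  where open ≤-Reasoning

tail-telescope : ∀ d j → sumTo x (d ℕ.+ suc j) - sumTo x (suc j) ≤ recip j - recip (d ℕ.+ j)
tail-telescope zero j = ≤-reflexive (trans (+-inverseʳ (sumTo x (suc j))) (sym (+-inverseʳ (recip j))))
tail-telescope (suc d) j = begin
  (sumTo x (d ℕ.+ suc j) + x (suc (d ℕ.+ suc j))) - sumTo x (suc j)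
    ≡⟨ solve 3 (λ a b c → (a :+ b) :- c := (a :- c) :+ b) refl (sumTo x (d ℕ.+ suc j)) (x (suc (d ℕ.+ suc j))) (sumTo x (suc j)) ⟩
  (sumTo x (d ℕ.+ suc j) - sumTo x (suc j)) + x (suc (d ℕ.+ suc j))
    ≤⟨ +-mono-≤ (tail-telescope d j) (≤-reflexive (cong (λ z → x (suc z)) (ℕ.+-suc d j))) ⟩
  (recip j - recip (d ℕ.+ j)) + x (suc (suc (d ℕ.+ j)))
    ≤⟨ +-monoʳ-≤ (recip j - recip (d ℕ.+ j)) (x≤recip-difference (d ℕ.+ j)) ⟩
  (recip j - recip (d ℕ.+ j)) + (recip (d ℕ.+ j) - recip (suc (d ℕ.+ j)))
    ≡⟨ solve 3 (λ a b c → (a :- b) :+ (b :- c) := a :- c) refl (recip j) (recip (d ℕ.+ j)) (recip (suc (d ℕ.+ j))) ⟩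
  recip j - recip (suc d ℕ.+ j) ∎
  where open ≤-Reasoning

x-tail : ∀ j a b → suc j ℕ.≤ a → a ℕ.≤ b → sumTo x b - sumTo x a ≤ recip j
x-tail j (suc a) b (s≤s j≤a) a≤b = begin
  sumTo x b - sumTo x (suc a)               ≡⟨ cong (λ z → sumTo x z - sumTo x (suc a)) (sym (ℕ.m∸n+n≡m a≤b)) ⟩
  sumTo x (d ℕ.+ suc a) - sumTo x (suc a)   ≤⟨ tail-telescope d a ⟩
  recip a - recip (d ℕ.+ a)                 ≤⟨ gap⇒≤ (0≤recip (d ℕ.+ a)) (solve 2 (λ p r → p := (p :- r) :+ r) refl (recip a) (recip (d ℕ.+ a))) ⟩
  recip a                                   ≤⟨ recip-antitone j≤a ⟩
  recip j                                   ∎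
  where
  open ≤-Reasoning
  d = b ℕ.∸ suc a

x^≤x : ∀ K m → x m ^ suc K ≤ x m
x^≤x K m = subst (x m * x m ^ K ≤_) (*-identityʳ (x m))
  (*-monoˡ-≤-nonNeg (x m) {{nonNegative (0≤x m)}} (≤1-^ K (0≤x m) (x≤1 m)))

square-x : ∀ m → ι (suc m) * ι (suc m) * x (suc m) ≡ 1ℚ
square-x m = begin
  M * M * x (suc m)        ≡⟨ cong (M * M *_) (x-suc m) ⟩
  M * M * recip m ^ 2      ≡⟨ solve 2 (λ M i → M :* M :* (i :* (i :* con 1ℚ)) := (M :* i) :* (M :* i)) refl M (recip m) ⟩
  (M * recip m) * (M * recip m) ≡⟨ cong (λ z → z * z) (ι-recip m) ⟩
  1ℚ                       ∎
  where
  open ≡-Reasoning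
  M = ι (suc m)

divide-bound : ∀ u N M i X → 0ℚ ≤ i → 0ℚ ≤ X → N * i ≡ 1ℚ → M * M * X ≡ 1ℚ → u * N ≤ M * M →
  u * (X * X) ≤ i * X
divide-bound u N M i X 0≤i 0≤X Ni≡1 MMX≡1 uN≤MM = begin
  u * (X * X)                                ≡⟨ solve 4 (λ u N i X → u :* (X :* X) := (u :* N) :* (i :* (X :* X)) :+ u :* (X :* X) :* (con 1ℚ :- N :* i)) refl u N i X ⟩
  (u * N) * (i * (X * X)) + u * (X * X) * (1ℚ - N * i)
                                             ≡⟨ cong (λ z → (u * N) * (i * (X * X)) + u * (X * X) * (1ℚ - z)) Ni≡1 ⟩
  (u * N) * (i * (X * X)) + u * (X * X) * (1ℚ - 1ℚ)
                                             ≡⟨ solve 2 (λ a b → a :+ b :* (con 1ℚ :- con 1ℚ) := a) refl ((u * N) * (i * (X * X))) (u * (X * X)) ⟩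
  (u * N) * (i * (X * X))                    ≤⟨ *-monoʳ-≤-nonNeg (i * (X * X)) {{nonNegative (0≤* 0≤i (0≤* 0≤X 0≤X))}} uN≤MM ⟩
  (M * M) * (i * (X * X))                    ≡⟨ solve 3 (λ M i X → (M :* M) :* (i :* (X :* X)) := i :* X :* (M :* M :* X)) refl M i X ⟩
  i * X * (M * M * X)                        ≡⟨ cong (i * X *_) MMX≡1 ⟩
  i * X * 1ℚ                                 ≡⟨ *-identityʳ (i * X) ⟩
  i * X                                      ∎
  where open ≤-Reasoning

-- The deviation of the coefficient B n m from its limit 2(-1)^{m-1}, weighted by x_m^{k+2}.
deviation : ℕ → ℕ → ℕ → ℚ
deviation k n m = (B n m - two * sign (ℕ.pred m)) * x m ^ suc (suc k)

-- |deviation| = 2 (1 - T n m) x_m^{k+2} ≤ 2 (1 - T n m) x_m² ≤ 2 x_m / n, by T-bounds.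
deviation-bound : ∀ k n m → m ℕ.< suc n → ∣ deviation k (suc n) (suc m) ∣ ≤ two * recip n * x (suc m)
deviation-bound k n m m<n = begin
  ∣ deviation k (suc n) (suc m) ∣
    ≡⟨ cong ∣_∣ (solve 4 (λ s T y t → ((t :* s :* T) :- t :* s) :* y := s :* (:- (t :* ((con 1ℚ :- T) :* y)))) refl (sign m) Tm y two) ⟩
  ∣ sign m * (- v) ∣                        ≡⟨ ∣p*q∣≡∣p∣*∣q∣ (sign m) (- v) ⟩
  ∣ sign m ∣ * ∣ - v ∣                      ≡⟨ cong₂ _*_ (∣sign∣ m) (trans (∣-p∣≡∣p∣ v) (0≤p⇒∣p∣≡p 0≤v)) ⟩
  1ℚ * v                                    ≡⟨ *-identityˡ v ⟩
  two * ((1ℚ - Tm) * y)                     ≤⟨ *-monoˡ-≤-nonNeg two {{nonNegative 0≤two}} (≤-trans y≤X² X²≤) ⟩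
  two * (recip n * X)                       ≡⟨ sym (*-assoc two (recip n) X) ⟩
  two * recip n * X                         ∎
  where
  open ≤-Reasoning
  Tm = T (suc n) (suc m)
  X = x (suc m)
  y = X ^ suc (suc k)
  v = two * ((1ℚ - Tm) * y)
  bounds : (0ℚ ≤ Tm) × (Tm ≤ 1ℚ) × ((1ℚ - Tm) * ι (suc n) ≤ ι (suc m) * ι (suc m))
  bounds = T-bounds (suc n) (suc m) m<n
  T≤1 : Tm ≤ 1ℚ
  T≤1 = proj₁ (proj₂ bounds)
  gap : (1ℚ - Tm) * ι (suc n) ≤ ι (suc m) * ι (suc m)
  gap = proj₂ (proj₂ bounds)
  0≤1-T : 0ℚ ≤ 1ℚ - Tm
  0≤1-T = ≤⇒0≤gap T≤1
  0≤v : 0ℚ ≤ v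
  0≤v = 0≤* 0≤two (0≤* 0≤1-T (0≤^ (suc (suc k)) (0≤x (suc m))))
  y≤X² : (1ℚ - Tm) * y ≤ (1ℚ - Tm) * (X * X)
  y≤X² = *-monoˡ-≤-nonNeg (1ℚ - Tm) {{nonNegative 0≤1-T}}
    (*-monoˡ-≤-nonNeg X {{nonNegative (0≤x (suc m))}} (x^≤x k (suc m)))
  X²≤ : (1ℚ - Tm) * (X * X) ≤ recip n * X
  X²≤ = divide-bound (1ℚ - Tm) (ι (suc n)) (ι (suc m)) (recip n) X (0≤recip n) (0≤x (suc m))
    (ι-recip n) (square-x m) gap

-- Summing, with Σ_{m ≤ n} x_m ≤ 2:  |Σ_m deviation| ≤ 4/n.
deviation-sum-bound : ∀ k n → ∣ sumTo (deviation k (suc n)) (suc n) ∣ ≤ two * recip n * two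
deviation-sum-bound k n = begin
  ∣ sumTo (deviation k (suc n)) (suc n) ∣         ≤⟨ sumTo-abs (deviation k (suc n)) (suc n) ⟩
  sumTo (λ m → ∣ deviation k (suc n) m ∣) (suc n) ≤⟨ sumTo-mono (suc n) (deviation-bound k n) ⟩
  sumTo (λ m → two * recip n * x m) (suc n)       ≡⟨ sumTo-scale (two * recip n) x (suc n) ⟩
  two * recip n * sumTo x (suc n)                 ≤⟨ *-monoˡ-≤-nonNeg (two * recip n) {{nonNegative (0≤* 0≤two (0≤recip n))}} Σx≤2 ⟩
  two * recip n * two                             ∎
  where
  open ≤-Reasoning
  Σx≤2 : sumTo x (suc n) ≤ two
  Σx≤2 = subst (_≤ two) (solve 2 (λ a b → (a :- b) :+ b := a) refl (sumTo x (suc n)) 1ℚ)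
    (+-monoˡ-≤ 1ℚ (x-tail 0 1 (suc n) (s≤s z≤n) (s≤s z≤n)))

double : ℕ → ℕ
double zero = zero
double (suc j) = suc (suc (double j))

double≡2* : ∀ j → double j ≡ 2 ℕ.* j
double≡2* zero = refl
double≡2* (suc j) = trans (cong (λ z → suc (suc z)) (double≡2* j)) (sym (ℕ.*-suc 2 j))

parity : ∀ n → n ≡ double ⌊ n /2⌋ ⊎ n ≡ suc (double ⌊ n /2⌋)
parity zero = inj₁ refl
parity (suc zero) = inj₂ refl
parity (suc (suc n)) with parity n
... | inj₁ even = inj₁ (cong (λ z → suc (suc z)) even)
... | inj₂ odd = inj₂ (cong (λ z → suc (suc z)) odd)

sign-double : ∀ j → sign (double j) ≡ 1ℚ
sign-double zero = refl
sign-double (suc j) = trans (solve 1 (λ p → :- (:- p) := p) refl (sign (double j))) (sign-double j)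

four : ℚ
four = two * two

-- The alternating sums Σ_{m ≤ n} 2(-1)^{m-1} x_m^K, i.e. the limits of the Q-sums.
module Alternating (K : ℕ) where

  y : ℕ → ℚ
  y m = x m ^ K

  r : ℚ
  r = x 2 ^ K

  Z : ℕ → ℚ
  Z = sumTo y

  alternating : ℕ → ℚ
  alternating = sumTo (λ m → two * sign (ℕ.pred m) * y m)

  -- x is multiplicative, so the even-indexed terms are 4^{-K} times the whole series.
  y-double : ∀ j → y (double (suc j)) ≡ r * y (suc j)
  y-double j = begin
    x (double (suc j)) ^ K        ≡⟨ cong (λ z → x z ^ K) (double≡2* (suc j)) ⟩
    x (2 ℕ.* suc j) ^ K           ≡⟨ cong (_^ K) (x-* 2 (suc j)) ⟩
    (x 2 * x (suc j)) ^ K         ≡⟨ ^-distrib-* (x 2) (x (suc j)) K ⟩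
    x 2 ^ K * x (suc j) ^ K       ∎
    where open ≡-Reasoning

  -- alternating (2j) = 2 Z(2j) - 4·4^{-K} Z(j): add all terms twice, subtract the even ones 4 times.
  alternating-even : ∀ j → alternating (double j) ≡ two * Z (double j) - four * r * Z j
  alternating-even zero = solve 1 (λ r → con 0ℚ := (con 1ℚ :+ con 1ℚ) :* con 0ℚ :- (con 1ℚ :+ con 1ℚ) :* (con 1ℚ :+ con 1ℚ) :* r :* con 0ℚ) refl r
  alternating-even (suc j) = begin
    (alternating d + two * sign d * y₁) + two * (- sign d) * y₂
      ≡⟨ cong₂ (λ u v → (u + two * v * y₁) + two * (- v) * y₂) (alternating-even j) (sign-double j) ⟩
    ((two * Z d - four * r * Z j) + two * 1ℚ * y₁) + two * (- 1ℚ) * y₂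
      ≡⟨ cong (λ z → ((two * Z d - four * r * Z j) + two * 1ℚ * y₁) + two * (- 1ℚ) * z) (y-double j) ⟩
    ((two * Z d - four * r * Z j) + two * 1ℚ * y₁) + two * (- 1ℚ) * (r * yⱼ)
      ≡⟨ solve 5 (λ Zd Zj y₁ yⱼ r →
           (((con 1ℚ :+ con 1ℚ) :* Zd :- (con 1ℚ :+ con 1ℚ) :* (con 1ℚ :+ con 1ℚ) :* r :* Zj) :+ (con 1ℚ :+ con 1ℚ) :* con 1ℚ :* y₁) :+ (con 1ℚ :+ con 1ℚ) :* (:- con 1ℚ) :* (r :* yⱼ)
           := (con 1ℚ :+ con 1ℚ) :* ((Zd :+ y₁) :+ r :* yⱼ) :- (con 1ℚ :+ con 1ℚ) :* (con 1ℚ :+ con 1ℚ) :* r :* (Zj :+ yⱼ)) refl (Z d) (Z j) y₁ yⱼ r ⟩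
    two * ((Z d + y₁) + r * yⱼ) - four * r * (Z j + yⱼ)
      ≡⟨ cong (λ z → two * ((Z d + y₁) + z) - four * r * (Z j + yⱼ)) (sym (y-double j)) ⟩
    two * ((Z d + y₁) + y₂) - four * r * (Z j + yⱼ) ∎
    where
    open ≡-Reasoning
    d = double j
    y₁ = y (suc d)
    y₂ = y (suc (suc d))
    yⱼ = y (suc j)

  alternating-odd : ∀ j → alternating (suc (double j)) ≡ two * Z (suc (double j)) - four * r * Z j
  alternating-odd j = begin
    alternating d + two * sign d * y₁            ≡⟨ cong₂ (λ u v → u + two * v * y₁) (alternating-even j) (sign-double j) ⟩
    (two * Z d - four * r * Z j) + two * 1ℚ * y₁
      ≡⟨ solve 4 (λ Zd Zj y₁ r → ((con 1ℚ :+ con 1ℚ) :* Zd :- (con 1ℚ :+ con 1ℚ) :* (con 1ℚ :+ con 1ℚ) :* r :* Zj) :+ (con 1ℚ :+ con 1ℚ) :* con 1ℚ :* y₁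
           := (con 1ℚ :+ con 1ℚ) :* (Zd :+ y₁) :- (con 1ℚ :+ con 1ℚ) :* (con 1ℚ :+ con 1ℚ) :* r :* Zj) refl (Z d) (Z j) y₁ r ⟩
    two * (Z d + y₁) - four * r * Z j            ∎
    where
    open ≡-Reasoning
    d = double j
    y₁ = y (suc d)

  alternating-split : ∀ n → alternating n ≡ two * Z n - four * r * Z ⌊ n /2⌋
  alternating-split n with parity n
  ... | inj₁ even = trans (cong alternating even)
        (trans (alternating-even ⌊ n /2⌋) (cong (λ z → two * Z z - four * r * Z ⌊ n /2⌋) (sym even)))
  ... | inj₂ odd = trans (cong alternating odd)
        (trans (alternating-odd ⌊ n /2⌋) (cong (λ z → two * Z z - four * r * Z ⌊ n /2⌋) (sym odd)))

open Alternating using (r; Z; alternating; alternating-split)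

two-minus-recip : ∀ D → + (2 ℕ.* suc D ℕ.∸ 1) / suc D ≡ two - recip D
two-minus-recip D = begin
  + (D ℕ.+ suc (D ℕ.+ 0)) / suc D       ≡⟨ fraction-as-product (D ℕ.+ suc (D ℕ.+ 0)) D ⟩
  ι (D ℕ.+ suc (D ℕ.+ 0)) * i           ≡⟨ cong (_* i) (trans (ι-+ D (suc (D ℕ.+ 0))) (cong (λ z → ι D + z) (trans (ι-suc (D ℕ.+ 0)) (cong (λ z → 1ℚ + z) (ι-+ D 0))))) ⟩
  (a + (1ℚ + (a + 0ℚ))) * i             ≡⟨ solve 2 (λ a i → (a :+ (con 1ℚ :+ (a :+ con 0ℚ))) :* i := (con 1ℚ :+ con 1ℚ) :* ((con 1ℚ :+ a) :* i) :- i) refl a i ⟩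
  two * ((1ℚ + a) * i) - i              ≡⟨ cong (λ z → two * z - i) (trans (cong (_* i) (sym (ι-suc D))) (ι-recip D)) ⟩
  two * 1ℚ - i                          ≡⟨ cong (_- i) (*-identityʳ two) ⟩
  two - recip D                         ∎
  where
  open ≡-Reasoning
  a = ι D
  i = recip D

coeff-closed : ∀ k → coeff (suc k) ≡ two - four * x 2 ^ suc k
coeff-closed k = begin
  coeff (suc k)
    ≡⟨ /-cong {{ℕ.m^n≢0 2 (2 ℕ.* suc k ℕ.∸ 2)}} {{ℕ.m^n≢0 4 k}} (cong (λ z → + (z ℕ.∸ 1)) numerator) denominator ⟩
  (+ (2 ℕ.* 4 ℕ.^ k ℕ.∸ 1) / 4 ℕ.^ k) {{ℕ.m^n≢0 4 k}}
    ≡⟨ over-power-of-4 (4 ℕ.^ k) {{ℕ.m^n≢0 4 k}} ⟩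
  two - (+ 1 / 4 ℕ.^ k) {{ℕ.m^n≢0 4 k}} ≡⟨ cong (λ z → two - z) (invPow-recip k 3) ⟩
  two - x 2 ^ k                          ≡⟨ cong (λ z → two - z) (sym (*-identityˡ (x 2 ^ k))) ⟩
  two - 1ℚ * x 2 ^ k                     ≡⟨ cong (λ z → two - z) (*-assoc four (x 2) (x 2 ^ k)) ⟩
  two - four * x 2 ^ suc k               ∎
  where
  open ≡-Reasoning
  2k+2≡ : 2 ℕ.* suc k ≡ suc (suc (2 ℕ.* k))
  2k+2≡ = ℕ.*-suc 2 k
  denominator : 2 ℕ.^ (2 ℕ.* suc k ℕ.∸ 2) ≡ 4 ℕ.^ k
  denominator = trans (cong (λ z → 2 ℕ.^ (z ℕ.∸ 2)) 2k+2≡) (sym (ℕ.^-*-assoc 2 2 k))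
  numerator : 2 ℕ.^ (2 ℕ.* suc k ℕ.∸ 1) ≡ 2 ℕ.* 4 ℕ.^ k
  numerator = trans (cong (λ z → 2 ℕ.^ (z ℕ.∸ 1)) 2k+2≡) (cong (2 ℕ.*_) (sym (ℕ.^-*-assoc 2 2 k)))
  over-power-of-4 : ∀ D .{{_ : ℕ.NonZero D}} → (+ (2 ℕ.* D ℕ.∸ 1) / D) ≡ two - (+ 1 / D)
  over-power-of-4 (suc D) = two-minus-recip D

error : ℕ → ℕ → ℚ
error k n = zetaPPartial k n - coeff k * zetaPartial (2 ℕ.* k) n

-- For k ≥ 2 the error is the deviation sum plus 4^{1-k} times a block of ζ(2k):
-- split B n m = (B n m - 2(-1)^{m-1}) + 2(-1)^{m-1} in the partial-fraction identity.
error-split : ∀ k n → error (suc (suc k)) n ≡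
  sumTo (deviation k n) n + four * r (suc (suc k)) * (Z (suc (suc k)) n - Z (suc (suc k)) ⌊ n /2⌋)
error-split k n = begin
  zetaPPartial K n - coeff K * zetaPartial (2 ℕ.* K) n
    ≡⟨ cong₂ _-_ (trans (partialFraction (suc k) n) limits) (cong₂ _*_ (coeff-closed (suc k)) (zetaPartial-even K n)) ⟩
  (sumTo (deviation k n) n + alternating K n) - (two - four * r K) * Z K n
    ≡⟨ cong (λ z → (sumTo (deviation k n) n + z) - (two - four * r K) * Z K n) (alternating-split K n) ⟩
  (sumTo (deviation k n) n + (two * Z K n - four * r K * Z K ⌊ n /2⌋)) - (two - four * r K) * Z K n
    ≡⟨ solve 5 (λ D t f Zn Zh → (D :+ (t :* Zn :- f :* Zh)) :- (t :- f) :* Zn := D :+ f :* (Zn :- Zh)) refl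
         (sumTo (deviation k n) n) two (four * r K) (Z K n) (Z K ⌊ n /2⌋) ⟩
  sumTo (deviation k n) n + four * r K * (Z K n - Z K ⌊ n /2⌋) ∎
  where
  open ≡-Reasoning
  K = suc (suc k)
  limits : Q K n ≡ sumTo (deviation k n) n + alternating K n
  limits = trans (sumTo-cong n (λ m _ →
      solve 3 (λ b a y → b :* y := (b :- (con 1ℚ :+ con 1ℚ) :* a) :* y :+ (con 1ℚ :+ con 1ℚ) :* a :* y) refl
        (B n (suc m)) (sign m) (x (suc m) ^ K)))
    (sumTo-+ (deviation k n) (λ m → two * sign (ℕ.pred m) * x m ^ K) n)

-- For k ≥ 2 and j < ⌊n/2⌋:  |error| ≤ 4/n + 1/(j+1) ≤ 5/(j+1).
error-bound : ∀ k n j → suc j ℕ.≤ ⌊ n /2⌋ → ∣ error (suc (suc k)) n ∣ ≤ ι 5 * recip j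
error-bound k (suc n) j j<half = begin
  ∣ error K (suc n) ∣                                    ≡⟨ cong ∣_∣ (error-split k (suc n)) ⟩
  ∣ deviations + four * r K * block ∣                    ≤⟨ ∣p+q∣≤∣p∣+∣q∣ deviations _ ⟩
  ∣ deviations ∣ + ∣ four * r K * block ∣                ≤⟨ +-mono-≤ (deviation-sum-bound k n) block-bound ⟩
  two * recip n * two + recip j                          ≤⟨ +-monoˡ-≤ (recip j) 4/n≤4/j ⟩
  two * recip j * two + recip j                          ≡⟨ solve 1 (λ i → (con 1ℚ :+ con 1ℚ) :* i :* (con 1ℚ :+ con 1ℚ) :+ i := (con 1ℚ :+ con 1ℚ :+ con 1ℚ :+ con 1ℚ :+ con 1ℚ) :* i) refl (recip j) ⟩
  ι 5 * recip j                                          ∎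
  where
  open ≤-Reasoning
  K = suc (suc k)
  deviations block : ℚ
  deviations = sumTo (deviation k (suc n)) (suc n)
  block = Z K (suc n) - Z K ⌊ suc n /2⌋
  half≤n : ⌊ suc n /2⌋ ℕ.≤ suc n
  half≤n = ℕ.⌊n/2⌋≤n (suc n)
  j≤n : j ℕ.≤ n
  j≤n = ℕ.≤-pred (ℕ.≤-trans j<half half≤n)
  4/n≤4/j : two * recip n * two ≤ two * recip j * two
  4/n≤4/j = *-monoʳ-≤-nonNeg two {{nonNegative 0≤two}}
    (*-monoˡ-≤-nonNeg two {{nonNegative 0≤two}} (recip-antitone j≤n))
  -- 4^{1-K} ≤ 1, and the block of ζ(2K) is dominated by the same block of Σ 1/m²
  0≤block : 0ℚ ≤ block
  0≤block = subst₂ (λ u v → u - v ≤ block) (sumTo-zero (suc n)) (sumTo-zero ⌊ suc n /2⌋)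
    (sumTo-block-mono (λ m → 0≤^ K (0≤x (suc m))) half≤n)
  block≤ : block ≤ sumTo x (suc n) - sumTo x ⌊ suc n /2⌋
  block≤ = sumTo-block-mono (λ m → x^≤x (suc k) (suc m)) half≤n
  0≤4r : 0ℚ ≤ four * r K
  0≤4r = 0≤* (0≤* 0≤two 0≤two) (0≤^ K (0≤x 2))
  4r≤1 : four * r K ≤ 1ℚ
  4r≤1 = subst (_≤ 1ℚ) (trans (sym (*-identityˡ (x 2 ^ suc k))) (*-assoc four (x 2) (x 2 ^ suc k)))
    (≤1-^ (suc k) (0≤x 2) (x≤1 2))
  block-bound : ∣ four * r K * block ∣ ≤ recip j
  block-bound = begin
    ∣ four * r K * block ∣     ≡⟨ 0≤p⇒∣p∣≡p (0≤* 0≤4r 0≤block) ⟩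
    four * r K * block         ≤⟨ ≤1-*ˡ 0≤block 4r≤1 ⟩
    block                      ≤⟨ block≤ ⟩
    sumTo x (suc n) - sumTo x ⌊ suc n /2⌋ ≤⟨ x-tail j ⌊ suc n /2⌋ (suc n) j<half half≤n ⟩
    recip j                    ∎

error-one : ∀ n → error 1 n ≡ 0ℚ
error-one n = begin
  zetaPPartial 1 n - 1ℚ * zetaPartial 2 n
    ≡⟨ cong₂ (λ u v → u - 1ℚ * v) (trans (zetaPPartial-suc 0 n) (sumTo-cong n (λ m _ → *-identityʳ (x (suc m)))))
         (sumℚ-range1 x n) ⟩
  sumTo x n - 1ℚ * sumTo x n  ≡⟨ solve 1 (λ a → a :- con 1ℚ :* a := con 0ℚ) refl (sumTo x n) ⟩
  0ℚ                          ∎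
  where open ≡-Reasoning

-- a/(L+1) < ε for L = a·d, where ε = p/d with p ≥ 1.
archimedean : ∀ a ε → 0ℚ < ε → ∃ λ L → ι a * recip L < ε
archimedean a (mkℚ (+ zero) d c) (*<* (ℤ.+<+ ()))
archimedean a (mkℚ ℤ.-[1+ p ] d c) (*<* ())
archimedean a ε@(mkℚ (+ suc p) d c) _ = L , subst (_< ε) (fraction-as-product a L) a/L<ε
  where
  L = a ℕ.* suc d
  cross : a ℕ.* suc d ℕ.< suc p ℕ.* suc L
  cross = ℕ.<-≤-trans (ℕ.n<1+n L) (ℕ.m≤n*m (suc L) (suc p))
  a/L<ε : (+ a / suc L) < ε
  a/L<ε = toℚᵘ-cancel-< (ℚᵘ.<-respˡ-≃ (ℚᵘ.≃-sym (fraction≃ (+ a) L)) (ℚᵘ.*<* (subst₂ ℤ._<_ (ℤ.pos-* a (suc d)) (ℤ.pos-* (suc p) (suc L)) (ℤ.+<+ cross))))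

-- The theorem: for k ≥ 2 choose J with 5/(J+1) < ε and N = 2(J+1), so that J < ⌊n/2⌋ for n ≥ N.
corollary4p9 : (k : ℕ) → 0 ℕ.< k → (ε : ℚ) → 0ℚ < ε →
    ∃ λ N → (n : ℕ) → N ℕ.≤ n →
    ∣ zetaPPartial k n - coeff k * zetaPartial (2 ℕ.* k) n ∣ < ε
corollary4p9 (suc zero) _ ε 0<ε = 0 , λ n _ → subst (_< ε) (sym (cong ∣_∣ (error-one n))) 0<ε
corollary4p9 (suc (suc k)) _ ε 0<ε with archimedean 5 ε 0<ε
... | J , 5/J<ε = suc J ℕ.+ suc J , λ n N≤n → ≤-<-trans (error-bound k n J (J<half N≤n)) 5/J<ε
  where
  J<half : ∀ {n} → suc J ℕ.+ suc J ℕ.≤ n → suc J ℕ.≤ ⌊ n /2⌋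
  J<half N≤n = subst (ℕ._≤ _) (sym (ℕ.n≡⌊n+n/2⌋ (suc J))) (ℕ.⌊n/2⌋-mono N≤n)
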